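{- Let $a\neq b$ be coprime positive integers, $A=\{a,b\}$ and $A'=\{1,a+b-1\}$. For a binary string $Y=Y(0)\cdots Y(a+b-1)$ of length $a+b$, let $X=\sigma_{a,a+b}(Y)$ be the string of length $a+b$ with $X(n)=Y(an \bmod (a+b))$ for $n=0,\ldots,a+b-1$. Then $Y^\infty\in\mathcal W^A$ if and only if $X^\infty\in\mathcal W^{A'}$.
   Context: For a finite nonempty set $A$ of positive integers let $\alpha=\max A$. For a seed $S=s_1\cdots s_\alpha\in\{0,1\}^\alpha$, define $w^{A,S}(-\alpha-1+j)=s_j$ for $j=1,\ldots,\alpha$ and $w^{A,S}(n)=1-\min\{w^{A,S}(n-x):x\in A\}$ for $n\ge0$. $\mathcal W^A=\{(w^{A,S}(n))_{n\ge0}: S\in\{0,1\}^\alpha\}$. $Y^\infty$ is the infinite word $YYY\cdots$ indexed from $0$. -}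

module Defs where

open import Data.Nat using (ℕ; zero; suc; _+_; _*_; _∸_; _⊔_; _%_)
open import Data.Nat.DivMod using (m%n<n)
open import Data.Bool using (Bool; not; _∧_; true; false)
open import Data.List using (List; foldr; map)
open import Data.Fin using (Fin; toℕ; fromℕ<)
open import Relation.Binary.PropositionalEquality using (_≡_)
open import Data.Product using (Σ; _×_)

maxA : List ℕ → ℕ
maxA = foldr _⊔_ 0

-- min over a nonempty list of bits, with 0 = false < 1 = true;
-- min of booleans is ∧.
minBits : List Bool → Bool
minBits = foldr _∧_ true


-- u ∈ 𝒲^A : there is a two-sided extension v, where v (α + n) = w(n) for
-- n ≥ 0 and v k for k < α encodes the seed (v k = w(k - α) = s_{k+1}),
-- such that the recurrence w(n) = 1 - min{ w(n - x) : x ∈ A } holds for n ≥ 0.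
-- (The seed v 0 … v (α-1) is arbitrary, and the recurrence determines w.)
InW : List ℕ → (ℕ → Bool) → Set
InW A u = Σ (ℕ → Bool) λ v →
  (∀ n → v (maxA A + n) ≡ u n) ×
  (∀ n → v (maxA A + n) ≡ not (minBits (map (λ x → v (maxA A + n ∸ x)) A)))

-- Y^∞ for a word Y of length N (N > 0 in our use), indexed from 0
periodic : (N : ℕ) → (Fin N → Bool) → ℕ → Bool
periodic zero    Y n = false
periodic (suc N) Y n = Y (fromℕ< (m%n<n n (suc N)))

sigma : (a N : ℕ) → (Fin N → Bool) → Fin N → Bool
sigma a zero    Y ()
sigma a (suc N) Y i = Y (fromℕ< (m%n<n (a * toℕ i) (suc N)))

-- A word Y^∞ of period N = a + b lies in 𝒲^{a,b} exactly when the recurrence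
-- holds cyclically, Y(n) = 1 - min{Y(n + b), Y(n + a)} for all n, since
-- n - a ≡ n + b and n - b ≡ n + a (mod N). Reading the positions n = a m of
-- this cyclic rule, and using a (N - 1) ≡ b (mod N), turns it into
-- X(m) = 1 - min{X(m + N - 1), X(m + 1)}, the cyclic form of the recurrence for
-- A' = {1, N - 1}. As a is invertible modulo N, every n is of the form a m, so
-- the two cyclic rules are equivalent.
module Submission where

open import Defs
open import Data.Nat using (ℕ; _+_; _∸_; _<_)
open import Data.Nat.Coprimality using (Coprime)
open import Data.Bool using (Bool)
open import Data.Fin using (Fin)
open import Data.List using (_∷_; [])
open import Relation.Binary.PropositionalEquality using (_≢_)
open import Function.Bundles using (_⇔_)

open import Level using (0ℓ)
open import Data.Nat using (zero; suc; pred; _*_; _%_; _≤_; NonZero; z≤n; s≤s)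
open import Data.Nat.Properties
open import Data.Nat.DivMod using (m%n<n; [m+n]%n≡m%n; %-distribˡ-*; m%n%n≡m%n)
open import Data.Nat.Coprimality using (coprime-Bézout; coprime-+)
import Data.Nat.Coprimality as Coprimality
open import Data.Nat.GCD using (module Bézout)
open import Data.Nat.Tactic.RingSolver using (solve-∀)
open import Data.Bool using (not)
open import Data.Fin using (toℕ; fromℕ<)
open import Data.Fin.Properties using (fromℕ<-cong; toℕ-fromℕ<)
open import Data.List using (List; map)
open import Data.List.Properties using (map-∘; map-cong; map-cong-local)
open import Data.List.Relation.Unary.All as All using (All; []; _∷_)
open import Data.List.Relation.Binary.Pointwise as Pointwise using (Pointwise; []; _∷_; Pointwise-≡⇒≡)
open import Data.Product using (∃; ∃₂; _×_; _,_)
open import Function.Base using (_∘_)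
open import Function.Bundles using (mk⇔)
open import Function.Properties.Equivalence using (⇔-setoid)
import Function.Properties.Equivalence as ⇔
open import Relation.Binary.PropositionalEquality
  using (_≡_; refl; sym; trans; cong; module ≡-Reasoning)

Periodic : ℕ → (ℕ → Bool) → Set
Periodic N u = ∀ n → u (n + N) ≡ u n

infix 4 _≡_[mod_]
_≡_[mod_] : ℕ → ℕ → ℕ → Set
p ≡ q [mod N ] = ∃₂ λ k l → p + k * N ≡ q + l * N

-- The recurrence of 𝒲^A with forward offsets d ∈ D in place of the backward
-- offsets -x, x ∈ A.
ForwardRule : List ℕ → (ℕ → Bool) → Set
ForwardRule D u = ∀ n → u n ≡ not (minBits (map (λ d → u (n + d)) D))

all-≤-maxA : ∀ A → All (_≤ maxA A) A
all-≤-maxA []      = []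
all-≤-maxA (x ∷ A) =
  m≤m⊔n x (maxA A) ∷ All.map (λ y≤ → ≤-trans y≤ (m≤n⊔m x (maxA A))) (all-≤-maxA A)

mod-reflexive : ∀ {N p q} → p ≡ q → p ≡ q [mod N ]
mod-reflexive p≡q = 0 , 0 , cong (_+ 0) p≡q

mod-sym : ∀ {N p q} → p ≡ q [mod N ] → q ≡ p [mod N ]
mod-sym (k , l , e) = l , k , sym e

+-congˡ-mod : ∀ {N p q} r → p ≡ q [mod N ] → r + p ≡ r + q [mod N ]
+-congˡ-mod {N} {p} {q} r (k , l , e) = k , l , (begin
  r + p + k * N    ≡⟨ +-assoc r p (k * N) ⟩
  r + (p + k * N)  ≡⟨ cong (r +_) e ⟩
  r + (q + l * N)  ≡⟨ +-assoc r q (l * N) ⟨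
  r + q + l * N    ∎)
  where open ≡-Reasoning

+-congʳ-mod : ∀ {N p q} r → p ≡ q [mod N ] → p + r ≡ q + r [mod N ]
+-congʳ-mod {p = p} {q} r p≡q
  rewrite +-comm p r | +-comm q r = +-congˡ-mod r p≡q

coprime⇒*-surjective-mod : ∀ {a N} .{{_ : NonZero N}} → Coprime a N →
                           ∀ n → ∃ λ m → a * m ≡ n [mod N ]
coprime⇒*-surjective-mod {a} {suc K} coprime n with coprime-Bézout coprime
... | Bézout.+- x y 1+yN≡xa = x * n , 0 , n * y , (begin
  a * (x * n) + 0 * suc K  ≡⟨ commute a x n K ⟩
  n * (x * a)              ≡⟨ cong (n *_) 1+yN≡xa ⟨
  n * (1 + y * suc K)      ≡⟨ distrib n y K ⟩
  n + n * y * suc K        ∎)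
  where
  open ≡-Reasoning
  commute : ∀ a x n K → a * (x * n) + 0 * suc K ≡ n * (x * a)
  commute = solve-∀
  distrib : ∀ n y K → n * (1 + y * suc K) ≡ n + n * y * suc K
  distrib = solve-∀
-- Here x a ≡ -1, so the inverse of a is -x ≡ K x.
... | Bézout.-+ x y 1+xa≡yN = x * n * K , n , n * K * y , (begin
  a * (x * n * K) + n * suc K  ≡⟨ distrib a x n K ⟩
  n + n * K * (1 + x * a)      ≡⟨ cong (λ t → n + n * K * t) 1+xa≡yN ⟩
  n + n * K * (y * suc K)      ≡⟨ reassoc n K y ⟩
  n + n * K * y * suc K        ∎)
  where
  open ≡-Reasoning
  distrib : ∀ a x n K → a * (x * n * K) + n * suc K ≡ n + n * K * (1 + x * a)
  distrib = solve-∀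
  reassoc : ∀ n K y → n + n * K * (y * suc K) ≡ n + n * K * y * suc K
  reassoc = solve-∀

module _ {N : ℕ} {u : ℕ → Bool} (periodic-u : Periodic N u) where

  periodic-+* : ∀ k n → u (n + k * N) ≡ u n
  periodic-+* zero    n = cong u (+-identityʳ n)
  periodic-+* (suc k) n = begin
    u (n + (N + k * N))  ≡⟨ cong u (+-assoc n N (k * N)) ⟨
    u (n + N + k * N)    ≡⟨ periodic-+* k (n + N) ⟩
    u (n + N)            ≡⟨ periodic-u n ⟩
    u n                  ∎
    where open ≡-Reasoning

  periodic-resp-mod : ∀ {p q} → p ≡ q [mod N ] → u p ≡ u q
  periodic-resp-mod {p} {q} (k , l , e) =
    trans (sym (periodic-+* k p)) (trans (cong u e) (periodic-+* l q))

  periodic-∸ : ∀ {p x} → x ≤ N → x ≤ p → u (p ∸ x) ≡ u (p + (N ∸ x))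
  periodic-∸ {p} {x} x≤N x≤p = begin
    u (p ∸ x)        ≡⟨ periodic-u (p ∸ x) ⟨
    u (p ∸ x + N)    ≡⟨ cong u (+-∸-comm N x≤p) ⟨
    u (p + N ∸ x)    ≡⟨ cong u (+-∸-assoc p x≤N) ⟩
    u (p + (N ∸ x))  ∎
    where open ≡-Reasoning

  forwardRule-cong : ∀ {D D′} → Pointwise _≡_[mod N ] D D′ →
                     ForwardRule D u ⇔ ForwardRule D′ u
  forwardRule-cong D≡D′ =
    mk⇔ (transfer D≡D′) (transfer (Pointwise.symmetric mod-sym D≡D′))
    where
    transfer : ∀ {D D′} → Pointwise _≡_[mod N ] D D′ →
               ForwardRule D u → ForwardRule D′ u
    transfer D≡D′ rule n = trans (rule n) (cong (not ∘ minBits)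
      (Pointwise-≡⇒≡ (Pointwise.map⁺ _ _
        (Pointwise.map (λ d≡d′ → periodic-resp-mod (+-congˡ-mod n d≡d′)) D≡D′))))

  inW⇔forwardRule : ∀ {A} .{{_ : NonZero N}} → All (_≤ N) A →
                    InW A u ⇔ ForwardRule (map (N ∸_) A) u
  inW⇔forwardRule {A} A≤N = mk⇔ to from
    where
    open ≡-Reasoning
    M = maxA A

    to : InW A u → ForwardRule (map (N ∸_) A) u
    to (v , v-ext , v-rec) n = begin
      u n              ≡⟨ periodic-u n ⟨
      u (n + N)        ≡⟨ v-ext (n + N) ⟨
      v (M + (n + N))  ≡⟨ v-rec (n + N) ⟩
      not (minBits (map (λ x → v (M + (n + N) ∸ x)) A))
        ≡⟨ cong (not ∘ minBits) (map-cong-local (All.map shift A≤N)) ⟩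
      not (minBits (map (λ x → u (n + (N ∸ x))) A))
        ≡⟨ cong (not ∘ minBits) (map-∘ A) ⟩
      not (minBits (map (λ d → u (n + d)) (map (N ∸_) A)))  ∎
      where
      shift : ∀ {x} → x ≤ N → v (M + (n + N) ∸ x) ≡ u (n + (N ∸ x))
      shift {x} x≤N = begin
        v (M + (n + N) ∸ x)  ≡⟨ cong v (+-∸-assoc M (≤-trans x≤N (m≤n+m N n))) ⟩
        v (M + (n + N ∸ x))  ≡⟨ v-ext (n + N ∸ x) ⟩
        u (n + N ∸ x)        ≡⟨ cong u (+-∸-assoc n x≤N) ⟩
        u (n + (N ∸ x))      ∎

    from : ForwardRule (map (N ∸_) A) u → InW A u
    from rule = v , v-ext , v-rec
      where
      c = M * pred N
      v : ℕ → Bool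
      v k = u (k + c)

      M+c≡M*N : M + c ≡ M * N
      M+c≡M*N = trans (sym (*-suc M (pred N))) (cong (M *_) (suc-pred N))

      v-ext : ∀ n → v (M + n) ≡ u n
      v-ext n = begin
        u (M + n + c)    ≡⟨ cong u (trans (cong (_+ c) (+-comm M n)) (+-assoc n M c)) ⟩
        u (n + (M + c))  ≡⟨ cong (λ t → u (n + t)) M+c≡M*N ⟩
        u (n + M * N)    ≡⟨ periodic-+* M n ⟩
        u n              ∎

      v-rec : ∀ n → v (M + n) ≡ not (minBits (map (λ x → v (M + n ∸ x)) A))
      v-rec n = begin
        u p  ≡⟨ rule p ⟩
        not (minBits (map (λ d → u (p + d)) (map (N ∸_) A)))
          ≡⟨ cong (not ∘ minBits) (map-∘ A) ⟨
        not (minBits (map (λ x → u (p + (N ∸ x))) A))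
          ≡⟨ cong (not ∘ minBits) (map-cong-local (All.zipWith shift (A≤N , all-≤-maxA A))) ⟩
        not (minBits (map (λ x → v (M + n ∸ x)) A))  ∎
        where
        p = M + n + c
        shift : ∀ {x} → x ≤ N × x ≤ M → u (p + (N ∸ x)) ≡ v (M + n ∸ x)
        shift {x} (x≤N , x≤M) = begin
          u (p + (N ∸ x))  ≡⟨ periodic-∸ x≤N (≤-trans x≤M+n (m≤m+n (M + n) c)) ⟨
          u (p ∸ x)        ≡⟨ cong u (+-∸-comm c x≤M+n) ⟩
          v (M + n ∸ x)    ∎
          where x≤M+n = ≤-trans x≤M (m≤m+n M n)

  forwardRule-dilate : ∀ {a E} {w : ℕ → Bool} →
                       (∀ n → ∃ λ m → a * m ≡ n [mod N ]) →
                       (∀ m → w m ≡ u (a * m)) →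
                       ForwardRule (map (a *_) E) u ⇔ ForwardRule E w
  forwardRule-dilate {a} {E} {w} surjective w≡u∘a* = mk⇔ to from
    where
    open ≡-Reasoning
    offsets : ∀ m → map (λ e → w (m + e)) E ≡ map (λ d → u (a * m + d)) (map (a *_) E)
    offsets m = trans (map-cong (λ e → trans (w≡u∘a* (m + e)) (cong u (*-distribˡ-+ a m e))) E)
                      (map-∘ E)

    to : ForwardRule (map (a *_) E) u → ForwardRule E w
    to rule m = trans (w≡u∘a* m) (trans (rule (a * m))
                  (cong (not ∘ minBits) (sym (offsets m))))

    from : ForwardRule E w → ForwardRule (map (a *_) E) u
    from rule n with surjective n
    ... | m , am≡n = begin
      u n        ≡⟨ periodic-resp-mod am≡n ⟨
      u (a * m)  ≡⟨ w≡u∘a* m ⟨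
      w m        ≡⟨ rule m ⟩
      not (minBits (map (λ e → w (m + e)) E))
        ≡⟨ cong (not ∘ minBits) (offsets m) ⟩
      not (minBits (map (λ d → u (a * m + d)) (map (a *_) E)))
        ≡⟨ cong (not ∘ minBits) (map-cong (λ d → periodic-resp-mod (+-congʳ-mod d am≡n)) (map (a *_) E)) ⟩
      not (minBits (map (λ d → u (n + d)) (map (a *_) E)))  ∎

periodic-Periodic : ∀ N Y → Periodic N (periodic N Y)
periodic-Periodic zero    Y n = refl
periodic-Periodic (suc K) Y n = cong Y (fromℕ<-cong _ _ ([m+n]%n≡m%n n (suc K)) _ _)

periodic-sigma : ∀ a N Y m → periodic N (sigma a N Y) m ≡ periodic N Y (a * m)
periodic-sigma a zero    Y m = refl
periodic-sigma a (suc K) Y m = cong Y (fromℕ<-cong _ _ a[m%N]%N≡am%N _ _)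
  where
  N = suc K
  open ≡-Reasoning
  a[m%N]%N≡am%N : (a * toℕ (fromℕ< (m%n<n m N))) % N ≡ (a * m) % N
  a[m%N]%N≡am%N = begin
    (a * toℕ (fromℕ< (m%n<n m N))) % N
      ≡⟨ cong (λ t → (a * t) % N) (toℕ-fromℕ< (m%n<n m N)) ⟩
    (a * (m % N)) % N                  ≡⟨ %-distribˡ-* a (m % N) N ⟩
    ((a % N) * ((m % N) % N)) % N      ≡⟨ cong (λ t → ((a % N) * t) % N) (m%n%n≡m%n m N) ⟩
    ((a % N) * (m % N)) % N            ≡⟨ %-distribˡ-* a m N ⟨
    (a * m) % N                        ∎

theorem3p13 : (a b : ℕ) → 0 < a → 0 < b → a ≢ b → Coprime a b →
    (Y : Fin (a + b) → Bool) →
    InW (a ∷ b ∷ []) (periodic (a + b) Y)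
      ⇔ InW (1 ∷ (a + b ∸ 1) ∷ []) (periodic (a + b) (sigma a (a + b) Y))
theorem3p13 a@(suc a′) b _ _ _ coprime Y = begin
  InW (a ∷ b ∷ []) Yᴺ
    ≈⟨ inW⇔forwardRule periodic-Y (a≤N ∷ b≤N ∷ []) ⟩
  ForwardRule (N ∸ a ∷ N ∸ b ∷ []) Yᴺ
    ≈⟨ forwardRule-cong periodic-Y Y-offsets ⟩
  ForwardRule (map (a *_) (N ∸ 1 ∷ 1 ∷ [])) Yᴺ
    ≈⟨ forwardRule-dilate periodic-Y {a} {N ∸ 1 ∷ 1 ∷ []} a*-surjective (periodic-sigma a N Y) ⟩
  ForwardRule (N ∸ 1 ∷ 1 ∷ []) Xᴺ
    ≈⟨ forwardRule-cong periodic-X X-offsets ⟩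
  ForwardRule (map (N ∸_) (1 ∷ N ∸ 1 ∷ [])) Xᴺ
    ≈⟨ ⇔.sym (inW⇔forwardRule periodic-X (1≤N ∷ m∸n≤m N 1 ∷ [])) ⟩
  InW (1 ∷ N ∸ 1 ∷ []) Xᴺ  ∎
  where
  open import Relation.Binary.Reasoning.Setoid (⇔-setoid 0ℓ)
  N = a + b
  Yᴺ Xᴺ : ℕ → Bool
  Yᴺ = periodic N Y
  Xᴺ = periodic N (sigma a N Y)

  periodic-Y : Periodic N Yᴺ
  periodic-Y = periodic-Periodic N Y
  periodic-X : Periodic N Xᴺ
  periodic-X = periodic-Periodic N (sigma a N Y)

  a≤N : a ≤ N
  a≤N = m≤m+n a b
  b≤N : b ≤ N
  b≤N = m≤n+m b a
  1≤N : 1 ≤ N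
  1≤N = s≤s z≤n

  a*-surjective : ∀ n → ∃ λ m → a * m ≡ n [mod N ]
  a*-surjective =
    coprime⇒*-surjective-mod (Coprimality.sym (coprime-+ (Coprimality.sym coprime)))

  -- a (N - 1) + N = a N + b
  N∸a≡a[N∸1] : N ∸ a ≡ a * (N ∸ 1) [mod N ]
  N∸a≡a[N∸1] rewrite m+n∸m≡n a b = a , 1 , identity a′ b
    where
    identity : ∀ a′ b → b + suc a′ * suc (a′ + b) ≡ suc a′ * (a′ + b) + 1 * suc (a′ + b)
    identity = solve-∀

  Y-offsets : Pointwise _≡_[mod N ] (N ∸ a ∷ N ∸ b ∷ []) (map (a *_) (N ∸ 1 ∷ 1 ∷ []))
  Y-offsets = N∸a≡a[N∸1] ∷ mod-reflexive (trans (m+n∸n≡m a b) (sym (*-identityʳ a))) ∷ []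

  X-offsets : Pointwise _≡_[mod N ] (N ∸ 1 ∷ 1 ∷ []) (map (N ∸_) (1 ∷ N ∸ 1 ∷ []))
  X-offsets = mod-reflexive refl ∷ mod-reflexive (sym (m∸[m∸n]≡n 1≤N)) ∷ []
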